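{- Let $N$ be a positive integer, let $a=1$ and $b=\lfloor\sqrt{N}\rfloor-1$. Then $$f(N,a,b)=\frac{\sqrt{(\lfloor\sqrt{N}\rfloor-1)^2+1}}{\sqrt{N}}.$$
   Context: For integers $N\ge1$ and $a,b$, the modular lattice is $L_{N,a,b}=\{(na \bmod N,\ nb \bmod N):0\le n<N\}$, and $\lambda(L_{N,a,b})$ denotes the length of a shortest non-zero vector of the lattice $L((a,b),(N,0),(0,N))$ of all integer linear combinations of $(a,b),(N,0),(0,N)$ (equivalently, the shortest distance between points of $L_{N,a,b}$ taken modulo $N$). Define $f(N,a,b)=\lambda(L_{N,a,b})/\sqrt{N}$. -}

module Defs where

open import Data.Integer using (ℤ; _+_; _*_; _≤_; 0ℤ)
open import Data.Product using (_×_; ∃-syntax)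
open import Relation.Binary.PropositionalEquality using (_≡_)
open import Relation.Nullary using (¬_)

InLattice : ℤ → ℤ → ℤ → ℤ → ℤ → Set
InLattice N a b x y =
  ∃[ n ] ∃[ k ] ∃[ l ] ((x ≡ n * a + k * N) × (y ≡ n * b + l * N))

NonZeroVec : ℤ → ℤ → Set
NonZeroVec x y = ¬ ((x ≡ 0ℤ) × (y ≡ 0ℤ))

sqNorm : ℤ → ℤ → ℤ
sqNorm x y = x * x + y * y

-- m is the squared length λ(L_{N,a,b})² of a shortest non-zero vector
-- of L((a,b),(N,0),(0,N)): attained, and a lower bound.
IsShortestSqLength : ℤ → ℤ → ℤ → ℤ → Set
IsShortestSqLength N a b m =
  (∃[ x ] ∃[ y ] (InLattice N a b x y × NonZeroVec x y × sqNorm x y ≡ m))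
  × (∀ x y → InLattice N a b x y → NonZeroVec x y → m ≤ sqNorm x y)

module Submission where

-- A point (x,y) lies in this lattice exactly when y = x·b + m·N for some
-- integer m (the congruence lemma).  The vector (1,b) has squared length
-- b² + 1; every other non-zero lattice vector is at least as long:
--   * m = 0: then y = x·b with x ≠ 0, so x² + y² ≥ 1 + b²;
--   * m ≠ 0 and |x| > b or |y| > b: one coordinate alone gives ≥ (b+1)²;
--   * m ≠ 0 and |x|, |y| ≤ b: impossible, since
--       N ≤ |m·N| = |y - x·b| ≤ |y| + |x|·b ≤ b + b² < (b+1)² ≤ N.  Only N ≥ (s-1+1)² = s²
-- is used; the hypothesis N < (s+1)² merely rules out s = 0 together with N ≥ 1.

open import Defs
open import Data.Nat using (ℕ; suc)
open import Data.Integer using (+_; 1ℤ; _-_)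
open import Data.Nat as Nat using ()
open import Data.Integer as Int using ()
open import Data.Integer using (ℤ; ∣_∣; -[1+_]; +≤+; 0ℤ)
import Data.Integer.Properties as IP
import Data.Nat.Properties as NP
open import Data.Integer.Tactic.RingSolver using (solve-∀)
open import Data.Product using (_,_; ∃-syntax)
open import Data.Sum using (_⊎_; inj₁; inj₂)
open import Relation.Binary.PropositionalEquality
open import Relation.Nullary using (yes; no)
open import Data.Empty using (⊥-elim)

square-above : ∀ {b X} → b Nat.< X → b Nat.* b Nat.+ 1 Nat.≤ X Nat.* X
square-above {b} {X} b<X = NP.≤-trans b²+1≤[b+1]² (NP.*-mono-≤ b<X b<X)
  where
  b²+1≤[b+1]² : b Nat.* b Nat.+ 1 Nat.≤ suc b Nat.* suc b
  b²+1≤[b+1]² rewrite NP.+-comm (b Nat.* b) 1 =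
    Nat.s≤s (NP.≤-trans (NP.*-monoʳ-≤ b (NP.n≤1+n b)) (NP.m≤n+m _ b))

outside-box : ∀ b X Y → b Nat.< X ⊎ b Nat.< Y →
  b Nat.* b Nat.+ 1 Nat.≤ X Nat.* X Nat.+ Y Nat.* Y
outside-box b X Y (inj₁ b<X) = NP.≤-trans (square-above b<X) (NP.m≤m+n _ _)
outside-box b X Y (inj₂ b<Y) = NP.≤-trans (square-above b<Y) (NP.m≤n+m _ _)

inside-box : ∀ b X Y → X Nat.≤ b → Y Nat.≤ b →
  Y Nat.+ X Nat.* b Nat.< suc b Nat.* suc b
inside-box b X Y X≤b Y≤b = Nat.s≤s (NP.+-mono-≤ Y≤b Xb≤b[b+1])
  where
  Xb≤b[b+1] : X Nat.* b Nat.≤ b Nat.* suc b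
  Xb≤b[b+1] = NP.≤-trans (NP.*-monoˡ-≤ b X≤b) (NP.*-monoʳ-≤ b (NP.n≤1+n b))

on-line : ∀ b X → 1 Nat.≤ X →
  b Nat.* b Nat.+ 1 Nat.≤ X Nat.* X Nat.+ (X Nat.* b) Nat.* (X Nat.* b)
on-line b X 1≤X rewrite NP.+-comm (X Nat.* X) ((X Nat.* b) Nat.* (X Nat.* b)) =
  NP.+-mono-≤ (NP.*-mono-≤ b≤Xb b≤Xb) (NP.*-mono-≤ 1≤X 1≤X)
  where
  b≤Xb : b Nat.≤ X Nat.* b
  b≤Xb = NP.≤-trans (NP.≤-reflexive (sym (NP.*-identityˡ b))) (NP.*-monoˡ-≤ b 1≤X)

square-abs : ∀ i → i Int.* i ≡ + (∣ i ∣ Nat.* ∣ i ∣)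
square-abs (+ n)    = sym (IP.pos-* n n)
square-abs -[1+ n ] = refl

sqNorm-abs : ∀ x y → sqNorm x y ≡ + (∣ x ∣ Nat.* ∣ x ∣ Nat.+ ∣ y ∣ Nat.* ∣ y ∣)
sqNorm-abs x y = begin
  x Int.* x Int.+ y Int.* y
    ≡⟨ cong₂ Int._+_ (square-abs x) (square-abs y) ⟩
  + (∣ x ∣ Nat.* ∣ x ∣) Int.+ + (∣ y ∣ Nat.* ∣ y ∣)
    ≡⟨ sym (IP.pos-+ (∣ x ∣ Nat.* ∣ x ∣) (∣ y ∣ Nat.* ∣ y ∣)) ⟩
  + (∣ x ∣ Nat.* ∣ x ∣ Nat.+ ∣ y ∣ Nat.* ∣ y ∣) ∎
  where open ≡-Reasoning

congruence : ∀ N B x y → InLattice N 1ℤ B x y → ∃[ m ] y ≡ x Int.* B Int.+ m Int.* N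
congruence N B x y (n , k , l , refl , refl) = l Int.- k Int.* B , identity n k l B N
  where
  identity : ∀ n k l B N → n Int.* B Int.+ l Int.* N
    ≡ (n Int.* 1ℤ Int.+ k Int.* N) Int.* B Int.+ (l Int.- k Int.* B) Int.* N
  identity = solve-∀

nonzero-multiple : ∀ N B x y m → m ≢ 0ℤ → y ≡ x Int.* B Int.+ m Int.* N →
  ∣ N ∣ Nat.≤ ∣ y ∣ Nat.+ ∣ x ∣ Nat.* ∣ B ∣
nonzero-multiple N B x y m m≢0 y≡ = begin
  ∣ N ∣                               ≤⟨ NP.m≤n*m ∣ N ∣ ∣ m ∣ ⦃ ∣m∣-nonZero ⦄ ⟩
  ∣ m ∣ Nat.* ∣ N ∣                   ≡⟨ sym (IP.abs-* m N) ⟩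
  ∣ m Int.* N ∣                       ≡⟨ cong ∣_∣ m*N≡y-xB ⟩
  ∣ y Int.- x Int.* B ∣               ≤⟨ IP.∣i-j∣≤∣i∣+∣j∣ y (x Int.* B) ⟩
  ∣ y ∣ Nat.+ ∣ x Int.* B ∣           ≡⟨ cong (∣ y ∣ Nat.+_) (IP.abs-* x B) ⟩
  ∣ y ∣ Nat.+ ∣ x ∣ Nat.* ∣ B ∣ ∎
  where
  open NP.≤-Reasoning
  ∣m∣-nonZero : Nat.NonZero ∣ m ∣
  ∣m∣-nonZero = Nat.≢-nonZero (λ ∣m∣≡0 → m≢0 (IP.∣i∣≡0⇒i≡0 ∣m∣≡0))
  difference : ∀ x B m N → m Int.* N ≡ (x Int.* B Int.+ m Int.* N) Int.- x Int.* B
  difference = solve-∀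
  m*N≡y-xB : m Int.* N ≡ y Int.- x Int.* B
  m*N≡y-xB = trans (difference x B m N) (cong (Int._- x Int.* B) (sym y≡))

shortest-bound : ∀ N b → suc b Nat.* suc b Nat.≤ N →
  ∀ x y m → y ≡ x Int.* + b Int.+ m Int.* + N → NonZeroVec x y →
  b Nat.* b Nat.+ 1 Nat.≤ ∣ x ∣ Nat.* ∣ x ∣ Nat.+ ∣ y ∣ Nat.* ∣ y ∣
shortest-bound N b [b+1]²≤N x y m y≡ nonzero with m Int.≟ 0ℤ
... | yes refl = on-line-case
  where
  y≡xb : y ≡ x Int.* + b
  y≡xb = trans y≡ (IP.+-identityʳ _)
  x≢0 : x ≢ 0ℤ
  x≢0 refl = nonzero (refl , y≡xb)
  ∣y∣≡∣x∣b : ∣ y ∣ ≡ ∣ x ∣ Nat.* b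
  ∣y∣≡∣x∣b = trans (cong ∣_∣ y≡xb) (IP.abs-* x (+ b))
  on-line-case : b Nat.* b Nat.+ 1 Nat.≤ ∣ x ∣ Nat.* ∣ x ∣ Nat.+ ∣ y ∣ Nat.* ∣ y ∣
  on-line-case rewrite ∣y∣≡∣x∣b =
    on-line b ∣ x ∣ (NP.n≢0⇒n>0 (λ ∣x∣≡0 → x≢0 (IP.∣i∣≡0⇒i≡0 ∣x∣≡0)))
... | no m≢0 with ∣ x ∣ Nat.≤? b | ∣ y ∣ Nat.≤? b
...   | no ∣x∣≰b | _         = outside-box b ∣ x ∣ ∣ y ∣ (inj₁ (NP.≰⇒> ∣x∣≰b))
...   | yes _    | no ∣y∣≰b  = outside-box b ∣ x ∣ ∣ y ∣ (inj₂ (NP.≰⇒> ∣y∣≰b))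
...   | yes ∣x∣≤b | yes ∣y∣≤b = ⊥-elim (NP.<⇒≱ (inside-box b ∣ x ∣ ∣ y ∣ ∣x∣≤b ∣y∣≤b) [b+1]²≤∣y∣+∣x∣b)
  where
  [b+1]²≤∣y∣+∣x∣b : suc b Nat.* suc b Nat.≤ ∣ y ∣ Nat.+ ∣ x ∣ Nat.* b
  [b+1]²≤∣y∣+∣x∣b = NP.≤-trans [b+1]²≤N (nonzero-multiple (+ N) (+ b) x y m m≢0 y≡)

lattice-lower-bound : ∀ N b → suc b Nat.* suc b Nat.≤ N →
  ∀ x y → InLattice (+ N) 1ℤ (+ b) x y → NonZeroVec x y →
  + b Int.* + b Int.+ 1ℤ Int.≤ sqNorm x y
lattice-lower-bound N b [b+1]²≤N x y inL nonzero
  with congruence (+ N) (+ b) x y inL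
... | m , y≡ rewrite sqNorm-abs x y | sym (IP.pos-* b b) =
  +≤+ (shortest-bound N b [b+1]²≤N x y m y≡ nonzero)

generator-in-lattice : ∀ N b → InLattice (+ N) 1ℤ (+ b) 1ℤ (+ b)
generator-in-lattice N b = 1ℤ , 0ℤ , 0ℤ , refl , sym b≡
  where
  b≡ : 1ℤ Int.* + b Int.+ 0ℤ Int.* + N ≡ + b
  b≡ = trans (IP.+-identityʳ _) (IP.*-identityˡ (+ b))

theorem1p3 : (N s : ℕ) → 1 Nat.≤ N → s Nat.* s Nat.≤ N → N Nat.< suc s Nat.* suc s →
    IsShortestSqLength (+ N) 1ℤ (+ s - 1ℤ)
    ((+ s - 1ℤ) Int.* (+ s - 1ℤ) Int.+ 1ℤ)
theorem1p3 N 0       1≤N _    N<1 = ⊥-elim (NP.<⇒≱ N<1 1≤N)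
theorem1p3 N (suc b) _   s²≤N _   =
  (1ℤ , + b , generator-in-lattice N b , (λ { (() , _) }) , IP.+-comm 1ℤ (+ b Int.* + b))
  , lattice-lower-bound N b s²≤N
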